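{- For $n\ge 2$ let $P_n$ be the total number of perimeter dominoes appearing among all domino tilings of the $2\times n$ rectangle, and let $f$ denote the Fibonacci numbers with $f(0)=0$, $f(1)=1$. Then $P_2=4$, $P_3=8$, and for $n>2$, $$P_{n+1} = P_n + P_{n-1} + 2f(n).$$ In closed form $P_n = \frac{4nf(n-1) + (2n+8)f(n)}{5}$, and $$\sum_{n\ge 2} P_nx^n = \frac{4x^2 - 4x^4 - 2x^5}{(1-x-x^2)^2}.$$
   Context: A domino is a $1\times 2$ rectangle; a domino tiling of a region is a tiling by dominoes on the unit grid. A domino in a tiling of a region $R$ is a (strong) perimeter domino if one of its sides of length $2$ lies in the boundary of $R$. $P_n = \sum_D \mathsf{perim}(D)$, the sum over all domino tilings $D$ of the $2\times n$ rectangle, where $\mathsf{perim}(D)$ is the number of perimeter dominoes in $D$. -}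

module Defs where

open import Data.Nat using (ℕ; zero; suc; _+_; _*_; _∸_; _≟_)
open import Data.Bool using (Bool; true; false; _∨_; if_then_else_)
open import Data.List using (List; []; _∷_; _++_; map)
open import Data.Nat.ListAction using (sum)
open import Data.Integer using (ℤ; +_) renaming (_+_ to _+ℤ_; _*_ to _*ℤ_; -_ to -ℤ_)
open import Relation.Nullary.Decidable using (⌊_⌋)

-- The 2 × n rectangle occupies [0,n] × [0,2] in the plane; its unit
-- cells are (row r, column c) with r ∈ {0,1}, c ∈ {0,…,n-1}.

data Domino : Set where
  -- vertical domino covering cells (0,c),(1,c), i.e. [c,c+1] × [0,2];
  -- its sides of length 2 are the segments x = c and x = c+1.
  vdom : (c : ℕ) → Domino
  -- horizontal domino in row r covering cells (r,c),(r,c+1),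
  -- i.e. [c,c+2] × [r,r+1]; its sides of length 2 are y = r and y = r+1.
  hdom : (r c : ℕ) → Domino

-- Domino tilings of the 2 × n rectangle, built column-block by
-- column-block from the left.  Every tiling of a 2 × n rectangle is
-- uniquely such a sequence: the leftmost column is either covered by a
-- vertical domino, or by two horizontal dominoes stacked on each other.
data Tiling : ℕ → Set where
  empty : Tiling 0
  addV  : ∀ {n} → Tiling n → Tiling (suc n)
  addH  : ∀ {n} → Tiling n → Tiling (suc (suc n))

dominoes : ∀ {n} → Tiling n → List Domino
dominoes empty = []
dominoes (addV {n} t) = vdom n ∷ dominoes t
dominoes (addH {n} t) = hdom 0 n ∷ hdom 1 n ∷ dominoes t

allTilings : (n : ℕ) → List (Tiling n)
allTilings zero = empty ∷ []
allTilings (suc zero) = addV empty ∷ []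
allTilings (suc (suc n)) =
  map addV (allTilings (suc n)) ++ map addH (allTilings n)

-- Is a side of length 2 of the domino contained in the boundary of the
-- 2 × n rectangle [0,n] × [0,2]?  (strong perimeter domino)
isPerimeter : ℕ → Domino → Bool
isPerimeter n (vdom c)   = ⌊ c ≟ 0 ⌋ ∨ ⌊ suc c ≟ n ⌋
isPerimeter n (hdom r c) = ⌊ r ≟ 0 ⌋ ∨ ⌊ suc r ≟ 2 ⌋

count : {A : Set} → (A → Bool) → List A → ℕ
count p [] = 0
count p (x ∷ xs) = (if p x then 1 else 0) + count p xs

perim : ∀ {n} → Tiling n → ℕ
perim {n} t = count (isPerimeter n) (dominoes t)

P : ℕ → ℕ
P n = sum (map perim (allTilings n))

fib : ℕ → ℕ
fib zero = 0
fib (suc zero) = 1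
fib (suc (suc n)) = fib (suc n) + fib n

Series : Set
Series = ℕ → ℤ

sumTo : ℕ → (ℕ → ℤ) → ℤ
sumTo zero g = g 0
sumTo (suc m) g = sumTo m g +ℤ g (suc m)

_⊛_ : Series → Series → Series
(a ⊛ b) m = sumTo m (λ i → a i *ℤ b (m ∸ i))

PGen : Series
PGen zero = + 0
PGen (suc zero) = + 0
PGen (suc (suc n)) = + P (suc (suc n))

-- Polynomial given by its list of coefficients (constant term first).
poly : List ℤ → Series
poly [] m = + 0
poly (a ∷ as) zero = a
poly (a ∷ as) (suc m) = poly as m

oneMinusXMinusX² : Series
oneMinusXMinusX² = poly (+ 1 ∷ -ℤ (+ 1) ∷ -ℤ (+ 1) ∷ [])

numerator : Series
numerator = poly (+ 0 ∷ + 0 ∷ + 4 ∷ + 0 ∷ -ℤ (+ 4) ∷ -ℤ (+ 2) ∷ [])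

{-# OPTIONS --safe #-}
-- Tilings of the 2 × n rectangle end in a vertical domino (fib n of them) or in two stacked
-- horizontal ones (fib (n - 1)).  Horizontal dominoes always lie on the top or bottom edge, and
-- a vertical domino is a perimeter domino only in the first or last column.  So the count
-- openP that ignores the right edge satisfies openP (n + 2) = openP (n + 1) + openP n
-- + 2 fib (n + 1), while for n ≥ 2 the last column adds exactly fib n: P n = openP n + fib n.
-- The closed form satisfies the same recurrence with the same two initial values, and
-- 1 − x − x² maps Σ P n xⁿ to a polynomial plus 2 Σ fib (n - 1) xⁿ, which a second factor
-- 1 − x − x² reduces to a polynomial.
module Submission where

open import Defs
open import Data.Bool using (true; false; if_then_else_)
open import Data.Integer as ℤ using (ℤ; +_; -[1+_])
import Data.Integer.Properties as ℤ
import Data.Integer.Tactic.RingSolver as ℤ-Solver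
open import Data.List using (List; []; _∷_; _++_; map; length)
open import Data.List.Properties using (map-++; map-∘; length-map; length-++)
open import Data.Nat using (ℕ; zero; suc; pred; _+_; _*_; _∸_; _≤_; _<_; s≤s; z≤n; _≟_)
open import Data.Nat.ListAction using (sum)
open import Data.Nat.ListAction.Properties using (sum-++)
open import Data.Nat.Properties
  using (*-zeroʳ; *-identityˡ; +-identityʳ; *-distribˡ-+; <⇒≢; <-trans; n<1+n)
open import Data.Nat.Tactic.RingSolver using (solve-∀)
open import Data.Product using (_×_; _,_)
open import Function using (_∘_)
open import Relation.Binary.PropositionalEquality
  using (_≡_; refl; sym; trans; cong; cong₂; module ≡-Reasoning)
open import Relation.Nullary.Decidable using (isYes≗does; dec-true; dec-false)

open ≡-Reasoning

sum-map-shift : {A : Set} (f g : A → ℕ) (c : ℕ) → (∀ x → f x ≡ c + g x) →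
                (xs : List A) → sum (map f xs) ≡ c * length xs + sum (map g xs)
sum-map-shift f g c f≡c+g [] = sym (cong (_+ 0) (*-zeroʳ c))
sum-map-shift f g c f≡c+g (x ∷ xs) = begin
  f x + sum (map f xs)
    ≡⟨ cong₂ _+_ (f≡c+g x) (sum-map-shift f g c f≡c+g xs) ⟩
  c + g x + (c * length xs + sum (map g xs))
    ≡⟨ regroup c (g x) (length xs) (sum (map g xs)) ⟩
  c * suc (length xs) + (g x + sum (map g xs)) ∎
  where
  regroup : ∀ c a l s → c + a + (c * l + s) ≡ c * (1 + l) + (a + s)
  regroup = solve-∀

length-allTilings : ∀ k → length (allTilings k) ≡ fib (suc k)
length-allTilings zero = refl
length-allTilings (suc zero) = refl
length-allTilings (suc (suc k)) = begin
  length (map addV (allTilings (suc k)) ++ map addH (allTilings k))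
    ≡⟨ length-++ (map addV (allTilings (suc k))) ⟩
  length (map addV (allTilings (suc k))) + length (map addH (allTilings k))
    ≡⟨ cong₂ _+_ (length-map addV (allTilings (suc k))) (length-map addH (allTilings k)) ⟩
  length (allTilings (suc k)) + length (allTilings k)
    ≡⟨ cong₂ _+_ (length-allTilings (suc k)) (length-allTilings k) ⟩
  fib (suc (suc k)) + fib (suc k) ∎

-- The tilings of the 2 × k rectangle, seen as the leftmost k columns of the 2 × N rectangle.
perimWeight : ℕ → ℕ → ℕ
perimWeight N k = sum (map (count (isPerimeter N) ∘ dominoes) (allTilings k))

-- Split off the last block: both horizontal dominoes of a 2 × 2 block lie along the top or
-- bottom edge, while a vertical domino in column k + 1 counts only if it is the last column.
perimWeight-step : ∀ N k →
  perimWeight N (2 + k) ≡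
    perimWeight N (1 + k) + perimWeight N k + 2 * fib (1 + k)
    + (if isPerimeter N (vdom (1 + k)) then 1 else 0) * fib (2 + k)
perimWeight-step N k = begin
  sum (map w (map addV (allTilings (1 + k)) ++ map addH (allTilings k)))
    ≡⟨ cong sum (map-++ w (map addV (allTilings (1 + k))) (map addH (allTilings k))) ⟩
  sum (map w (map addV (allTilings (1 + k))) ++ map w (map addH (allTilings k)))
    ≡⟨ sum-++ (map w (map addV (allTilings (1 + k)))) (map w (map addH (allTilings k))) ⟩
  sum (map w (map addV (allTilings (1 + k)))) + sum (map w (map addH (allTilings k)))
    ≡⟨ sym (cong₂ _+_ (cong sum (map-∘ (allTilings (1 + k)))) (cong sum (map-∘ (allTilings k)))) ⟩
  sum (map (w ∘ addV) (allTilings (1 + k))) + sum (map (w ∘ addH) (allTilings k))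
    ≡⟨ cong₂ _+_ (sum-map-shift _ w v (λ _ → refl) (allTilings (1 + k)))
                 (sum-map-shift _ w 2 (λ _ → refl) (allTilings k)) ⟩
  v * length (allTilings (1 + k)) + perimWeight N (1 + k) + (2 * length (allTilings k) + perimWeight N k)
    ≡⟨ cong₂ (λ a b → v * a + perimWeight N (1 + k) + (2 * b + perimWeight N k))
             (length-allTilings (1 + k)) (length-allTilings k) ⟩
  v * fib (2 + k) + perimWeight N (1 + k) + (2 * fib (1 + k) + perimWeight N k)
    ≡⟨ regroup (v * fib (2 + k)) (perimWeight N (1 + k)) (2 * fib (1 + k)) (perimWeight N k) ⟩
  perimWeight N (1 + k) + perimWeight N k + 2 * fib (1 + k) + v * fib (2 + k) ∎
  where
  w : ∀ {n} → Tiling n → ℕ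
  w = count (isPerimeter N) ∘ dominoes
  v : ℕ
  v = if isPerimeter N (vdom (1 + k)) then 1 else 0
  regroup : ∀ a b c d → a + b + (c + d) ≡ b + d + c + a
  regroup = solve-∀

vdom-isPerimeter-interior : ∀ {N k} → 2 + k < N → isPerimeter N (vdom (1 + k)) ≡ false
vdom-isPerimeter-interior {N} {k} k+2<N =
  trans (isYes≗does (2 + k ≟ N)) (dec-false (2 + k ≟ N) (<⇒≢ k+2<N))

vdom-isPerimeter-last : ∀ k → isPerimeter (2 + k) (vdom (1 + k)) ≡ true
vdom-isPerimeter-last k = trans (isYes≗does (2 + k ≟ 2 + k)) (dec-true (2 + k ≟ 2 + k) refl)

-- P k with the right edge of the rectangle not counted as boundary.
openP : ℕ → ℕ
openP zero = 0
openP (suc zero) = 1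
openP (suc (suc k)) = openP (suc k) + openP k + 2 * fib (suc k)

perimWeight-interior : ∀ {N} k → k < N → perimWeight N k ≡ openP k
perimWeight-interior zero _ = refl
perimWeight-interior (suc zero) _ = refl
perimWeight-interior {N} (suc (suc k)) k+2<N = begin
  perimWeight N (2 + k)
    ≡⟨ perimWeight-step N k ⟩
  perimWeight N (1 + k) + perimWeight N k + 2 * fib (1 + k)
    + (if isPerimeter N (vdom (1 + k)) then 1 else 0) * fib (2 + k)
    ≡⟨ cong (λ b → perimWeight N (1 + k) + perimWeight N k + 2 * fib (1 + k)
                   + (if b then 1 else 0) * fib (2 + k))
            (vdom-isPerimeter-interior k+2<N) ⟩
  perimWeight N (1 + k) + perimWeight N k + 2 * fib (1 + k) + 0
    ≡⟨ +-identityʳ _ ⟩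
  perimWeight N (1 + k) + perimWeight N k + 2 * fib (1 + k)
    ≡⟨ cong₂ (λ a b → a + b + 2 * fib (1 + k))
             (perimWeight-interior (suc k) k+1<N) (perimWeight-interior k (<-trans (n<1+n k) k+1<N)) ⟩
  openP (2 + k) ∎
  where
  k+1<N : 1 + k < N
  k+1<N = <-trans (n<1+n (1 + k)) k+2<N

P≡openP+fib : ∀ k → P (2 + k) ≡ openP (2 + k) + fib (2 + k)
P≡openP+fib k = begin
  perimWeight (2 + k) (2 + k)
    ≡⟨ perimWeight-step (2 + k) k ⟩
  perimWeight (2 + k) (1 + k) + perimWeight (2 + k) k + 2 * fib (1 + k)
    + (if isPerimeter (2 + k) (vdom (1 + k)) then 1 else 0) * fib (2 + k)
    ≡⟨ cong (λ b → perimWeight (2 + k) (1 + k) + perimWeight (2 + k) k + 2 * fib (1 + k)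
                   + (if b then 1 else 0) * fib (2 + k))
            (vdom-isPerimeter-last k) ⟩
  perimWeight (2 + k) (1 + k) + perimWeight (2 + k) k + 2 * fib (1 + k) + 1 * fib (2 + k)
    ≡⟨ cong₂ (λ a b → a + b + 2 * fib (1 + k) + 1 * fib (2 + k))
             (perimWeight-interior (1 + k) (n<1+n (1 + k)))
             (perimWeight-interior k (<-trans (n<1+n k) (n<1+n (1 + k)))) ⟩
  openP (2 + k) + 1 * fib (2 + k)
    ≡⟨ cong (λ f → openP (2 + k) + f) (*-identityˡ (fib (2 + k))) ⟩
  openP (2 + k) + fib (2 + k) ∎

P-recurrence : ∀ k → P (4 + k) ≡ P (3 + k) + P (2 + k) + 2 * fib (3 + k)
P-recurrence k = begin
  P (4 + k)
    ≡⟨ P≡openP+fib (2 + k) ⟩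
  openP (3 + k) + openP (2 + k) + 2 * fib (3 + k) + (fib (3 + k) + fib (2 + k))
    ≡⟨ interchange (openP (3 + k)) (openP (2 + k)) (2 * fib (3 + k)) (fib (3 + k)) (fib (2 + k)) ⟩
  (openP (3 + k) + fib (3 + k)) + (openP (2 + k) + fib (2 + k)) + 2 * fib (3 + k)
    ≡⟨ sym (cong₂ (λ a b → a + b + 2 * fib (3 + k)) (P≡openP+fib (1 + k)) (P≡openP+fib k)) ⟩
  P (3 + k) + P (2 + k) + 2 * fib (3 + k) ∎
  where
  interchange : ∀ a b c d e → a + b + c + (d + e) ≡ (a + d) + (b + e) + c
  interchange = solve-∀

recurrence-determined : (d a b : ℕ → ℕ) →
  (∀ n → a (2 + n) ≡ a (1 + n) + a n + d n) →
  (∀ n → b (2 + n) ≡ b (1 + n) + b n + d n) →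
  a 0 ≡ b 0 → a 1 ≡ b 1 → ∀ n → a n ≡ b n
recurrence-determined d a b rec-a rec-b a0≡b0 a1≡b1 = go
  where
  go : ∀ n → a n ≡ b n
  go zero = a0≡b0
  go (suc zero) = a1≡b1
  go (suc (suc n)) = begin
    a (2 + n)             ≡⟨ rec-a n ⟩
    a (1 + n) + a n + d n ≡⟨ cong₂ (λ x y → x + y + d n) (go (suc n)) (go n) ⟩
    b (1 + n) + b n + d n ≡⟨ sym (rec-b n) ⟩
    b (2 + n)             ∎

closedForm : ℕ → ℕ
closedForm n = 4 * n * fib (n ∸ 1) + (2 * n + 8) * fib n

-- With x = fib (1 + k) and y = fib (2 + k), fib (3 + k) and fib (4 + k) unfold to y + x and (y + x) + y.
closedForm-recurrence : ∀ k →
  closedForm (4 + k) ≡ closedForm (3 + k) + closedForm (2 + k) + 10 * fib (3 + k)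
closedForm-recurrence k = identity k (fib (1 + k)) (fib (2 + k))
  where
  identity : ∀ k x y →
    4 * (4 + k) * (y + x) + (2 * (4 + k) + 8) * ((y + x) + y)
      ≡ (4 * (3 + k) * y + (2 * (3 + k) + 8) * (y + x))
        + (4 * (2 + k) * x + (2 * (2 + k) + 8) * y)
        + 10 * (y + x)
  identity = solve-∀

P-closedForm : ∀ k → 5 * P (2 + k) ≡ closedForm (2 + k)
P-closedForm = recurrence-determined (λ n → 10 * fib (3 + n))
  (λ n → 5 * P (2 + n)) (λ n → closedForm (2 + n))
  (λ n → trans (cong (5 *_) (P-recurrence n)) (distrib (P (3 + n)) (P (2 + n)) (fib (3 + n))))
  closedForm-recurrence refl refl
  where
  distrib : ∀ p q f → 5 * (p + q + 2 * f) ≡ 5 * p + 5 * q + 10 * f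
  distrib = solve-∀

sumTo-suc : ∀ m (g : ℕ → ℤ) → sumTo (suc m) g ≡ g 0 ℤ.+ sumTo m (g ∘ suc)
sumTo-suc zero g = refl
sumTo-suc (suc m) g = begin
  sumTo m g ℤ.+ g (suc m) ℤ.+ g (2 + m)
    ≡⟨ cong (ℤ._+ g (2 + m)) (sumTo-suc m g) ⟩
  g 0 ℤ.+ sumTo m (g ∘ suc) ℤ.+ g (2 + m)
    ≡⟨ ℤ.+-assoc (g 0) (sumTo m (g ∘ suc)) (g (2 + m)) ⟩
  g 0 ℤ.+ sumTo (suc m) (g ∘ suc) ∎

sumTo-cong : ∀ m {f g : ℕ → ℤ} → (∀ i → f i ≡ g i) → sumTo m f ≡ sumTo m g
sumTo-cong zero f≡g = f≡g 0
sumTo-cong (suc m) f≡g = cong₂ ℤ._+_ (sumTo-cong m f≡g) (f≡g (suc m))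

sumTo-zero : ∀ m → sumTo m (λ _ → + 0) ≡ + 0
sumTo-zero zero = refl
sumTo-zero (suc m) = cong (ℤ._+ + 0) (sumTo-zero m)

⊛-congˡ : ∀ {f g : Series} (a : Series) → (∀ i → f i ≡ g i) → ∀ m → (f ⊛ a) m ≡ (g ⊛ a) m
⊛-congˡ a f≡g m = sumTo-cong m (λ i → cong (ℤ._* a (m ∸ i)) (f≡g i))

-- linComb cs a m = Σᵢ csᵢ · a (m − i), meaningful when length cs ≤ m + 1.
linComb : List ℤ → Series → ℕ → ℤ
linComb [] a m = + 0
linComb (c ∷ cs) a m = c ℤ.* a m ℤ.+ linComb cs a (pred m)

poly-⊛-linComb : ∀ cs (a : Series) m → length cs ≤ suc m → (poly cs ⊛ a) m ≡ linComb cs a m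
poly-⊛-linComb [] a m _ = sumTo-zero m
poly-⊛-linComb (c ∷ []) a zero _ = sym (ℤ.+-identityʳ (c ℤ.* a 0))
poly-⊛-linComb (c ∷ cs) a (suc m) (s≤s l≤m+1) = begin
  sumTo (suc m) (λ i → poly (c ∷ cs) i ℤ.* a (suc m ∸ i))
    ≡⟨ sumTo-suc m (λ i → poly (c ∷ cs) i ℤ.* a (suc m ∸ i)) ⟩
  c ℤ.* a (suc m) ℤ.+ (poly cs ⊛ a) m
    ≡⟨ cong (λ s → c ℤ.* a (suc m) ℤ.+ s) (poly-⊛-linComb cs a m l≤m+1) ⟩
  c ℤ.* a (suc m) ℤ.+ linComb cs a m ∎

-- (1 − x − x²)² = 1 − 2x − x² + 2x³ + x⁴
squareCoeffs : List ℤ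
squareCoeffs = + 1 ∷ -[1+ 1 ] ∷ -[1+ 0 ] ∷ + 2 ∷ + 1 ∷ []

oneMinusXMinusX²-squared : ∀ m → (oneMinusXMinusX² ⊛ oneMinusXMinusX²) m ≡ poly squareCoeffs m
oneMinusXMinusX²-squared 0 = refl
oneMinusXMinusX²-squared 1 = refl
oneMinusXMinusX²-squared 2 = refl
oneMinusXMinusX²-squared 3 = refl
oneMinusXMinusX²-squared 4 = refl
oneMinusXMinusX²-squared (suc (suc (suc (suc (suc k))))) =
  poly-⊛-linComb (+ 1 ∷ -[1+ 0 ] ∷ -[1+ 0 ] ∷ []) oneMinusXMinusX² (5 + k) (s≤s (s≤s (s≤s z≤n)))

squareCoeffs-annihilates : (p d : Series) →
  (∀ n → p (2 + n) ≡ p (1 + n) ℤ.+ p n ℤ.+ d n) →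
  (∀ n → d (2 + n) ≡ d (1 + n) ℤ.+ d n) →
  ∀ n → linComb squareCoeffs p (4 + n) ≡ + 0
squareCoeffs-annihilates p d rec-p rec-d n =
  identity (p n) (p (1 + n)) (p (2 + n)) (p (3 + n)) (p (4 + n)) (d n) (d (1 + n)) (d (2 + n))
           (rec-p n) (rec-p (1 + n)) (rec-p (2 + n)) (rec-d n)
  where
  -- The left-hand side is linComb squareCoeffs p (4 + n), unfolded.
  identity : ∀ p₀ p₁ p₂ p₃ p₄ d₀ d₁ d₂ →
    p₂ ≡ p₁ ℤ.+ p₀ ℤ.+ d₀ → p₃ ≡ p₂ ℤ.+ p₁ ℤ.+ d₁ → p₄ ≡ p₃ ℤ.+ p₂ ℤ.+ d₂ → d₂ ≡ d₁ ℤ.+ d₀ →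
    + 1 ℤ.* p₄ ℤ.+ (-[1+ 1 ] ℤ.* p₃ ℤ.+ (-[1+ 0 ] ℤ.* p₂ ℤ.+ (+ 2 ℤ.* p₁ ℤ.+ (+ 1 ℤ.* p₀ ℤ.+ + 0))))
      ≡ + 0
  identity p₀ p₁ _ _ _ d₀ d₁ _ refl refl refl refl = ℤ-Solver.solve (p₀ ∷ p₁ ∷ d₀ ∷ d₁ ∷ [])

square⊛PGen≡numerator : ∀ m → ((oneMinusXMinusX² ⊛ oneMinusXMinusX²) ⊛ PGen) m ≡ numerator m
square⊛PGen≡numerator 0 = refl
square⊛PGen≡numerator 1 = refl
square⊛PGen≡numerator 2 = refl
square⊛PGen≡numerator 3 = refl
square⊛PGen≡numerator 4 = refl
square⊛PGen≡numerator 5 = refl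
square⊛PGen≡numerator 6 = refl
square⊛PGen≡numerator m@(suc (suc (suc (suc (suc (suc (suc k))))))) = begin
  ((oneMinusXMinusX² ⊛ oneMinusXMinusX²) ⊛ PGen) m
    ≡⟨ ⊛-congˡ PGen oneMinusXMinusX²-squared m ⟩
  (poly squareCoeffs ⊛ PGen) m
    ≡⟨ poly-⊛-linComb squareCoeffs PGen m (s≤s (s≤s (s≤s (s≤s (s≤s z≤n))))) ⟩
  linComb squareCoeffs PGen m
    ≡⟨ squareCoeffs-annihilates (λ n → PGen (3 + n)) (λ n → + (2 * fib (4 + n)))
         (λ n → cong +_ (P-recurrence (1 + n)))
         (λ n → cong +_ (*-distribˡ-+ 2 (fib (5 + n)) (fib (4 + n)))) k ⟩
  + 0 ∎

proposition5p6 : (P 2 ≡ 4) × (P 3 ≡ 8)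
    × (∀ (n : ℕ) → 2 < n → P (suc n) ≡ P n + P (n ∸ 1) + 2 * fib n)
    × (∀ (n : ℕ) → 2 ≤ n → 5 * P n ≡ 4 * n * fib (n ∸ 1) + (2 * n + 8) * fib n)
    × (∀ (m : ℕ) → ((oneMinusXMinusX² ⊛ oneMinusXMinusX²) ⊛ PGen) m ≡ numerator m)
proposition5p6 = refl , refl , recurrence , closed , square⊛PGen≡numerator
  where
  recurrence : ∀ n → 2 < n → P (suc n) ≡ P n + P (n ∸ 1) + 2 * fib n
  recurrence (suc (suc (suc k))) (s≤s (s≤s (s≤s z≤n))) = P-recurrence k
  closed : ∀ n → 2 ≤ n → 5 * P n ≡ closedForm n
  closed (suc (suc k)) (s≤s (s≤s z≤n)) = P-closedForm k
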